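{- For every positive integer $n$, $S^2_n(X_1,\dots,X_n)$ can be computed by a homogeneous $\Sigma\Pi\Sigma$ circuit over the field $\mathbb{C}$ of complex numbers using $\lceil \frac{n}{2}\rceil$ multiplication gates.
   Context: $S_n^2(X_1,\dots,X_n) = \sum_{1\le i<j\le n} X_iX_j$. A $\Sigma\Pi\Sigma$ circuit over a field $\mathbb{F}$ in variables $X_1,\dots,X_n$ is an expression $\sum_{i=1}^r \prod_{j=1}^{s_i} L_{ij}(X)$ where each $L_{ij}$ is a linear form $a_0+\sum_{k=1}^n a_kX_k$ with $a_0,\dots,a_n\in\mathbb{F}$; $r$ is its number of multiplication gates. It is homogeneous if every $L_{ij}$ has constant term $0$. It computes a polynomial $P$ if the expression equals $P$ in $\mathbb{F}[X_1,\dots,X_n]$. -}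

module Defs where

open import Level using (Level; _⊔_; suc)
open import Algebra.Bundles using (CommutativeRing)
open import Data.Nat as ℕ using (ℕ; zero) renaming (suc to 1+)
open import Data.Fin using (Fin) renaming (zero to fzero; suc to fsuc)
open import Data.List using (List; []; _∷_; length; foldr; _++_)
open import Data.Vec using (Vec)
import Data.Vec as Vec
open import Data.Product using (Σ; ∃; _×_; _,_)
open import Relation.Nullary using (¬_)

record Field (c ℓ : Level) : Set (suc (c ⊔ ℓ)) where
  field
    commRing : CommutativeRing c ℓ
  open CommutativeRing commRing public
  field
    1≉0     : ¬ (1# ≈ 0#)
    inverse : ∀ x → ¬ (x ≈ 0#) → Σ Carrier λ y → (x * y) ≈ 1#

module FieldTheory {c ℓ} (F : Field c ℓ) where
  open Field F

  natCast : ℕ → Carrier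
  natCast zero   = 0#
  natCast (1+ k) = 1# + natCast k

  CharZero : Set ℓ
  CharZero = ∀ k → ¬ (natCast (1+ k) ≈ 0#)

  evalPoly : List Carrier → Carrier → Carrier
  evalPoly []       x = 0#
  evalPoly (a ∷ as) x = a + x * evalPoly as x

  -- algebraically closed: every monic polynomial  c₀ + c₁ x + … + c_{d-1} x^{d-1} + x^d
  -- of degree d ≥ 1 has a root.
  AlgClosed : Set (c ⊔ ℓ)
  AlgClosed = ∀ (cs : List Carrier) → 1 ℕ.≤ length cs →
              ∃ λ x → evalPoly (cs ++ (1# ∷ [])) x ≈ 0#

  sumFin : ∀ {n} → (Fin n → Carrier) → Carrier
  sumFin {zero}  f = 0#
  sumFin {1+ n}  f = f fzero + sumFin (λ i → f (fsuc i))

  -- S²_n(x) = Σ_{i<j} x_i x_j   (recursion: x₀ · (x₁+…+x_{n-1}) + S²_{n-1}(x₁,…,x_{n-1}))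
  S2 : ∀ n → (Fin n → Carrier) → Carrier
  S2 zero   x = 0#
  S2 (1+ n) x = x fzero * sumFin (λ i → x (fsuc i)) + S2 n (λ i → x (fsuc i))

  record LinForm (n : ℕ) : Set c where
    constructor linForm
    field
      const  : Carrier
      coeffs : Fin n → Carrier

  evalLin : ∀ {n} → LinForm n → (Fin n → Carrier) → Carrier
  evalLin (linForm a₀ a) x = a₀ + sumFin (λ k → a k * x k)

  HomogeneousLin : ∀ {n} → LinForm n → Set ℓ
  HomogeneousLin L = LinForm.const L ≈ 0#

  Gate : ℕ → Set c
  Gate n = List (LinForm n)

  evalGate : ∀ {n} → Gate n → (Fin n → Carrier) → Carrier
  evalGate g x = foldr (λ L acc → evalLin L x * acc) 1# g

  Circuit : ℕ → ℕ → Set c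
  Circuit n r = Vec (Gate n) r

  evalCircuit : ∀ {n r} → Circuit n r → (Fin n → Carrier) → Carrier
  evalCircuit C x = Vec.foldr _ (λ g acc → evalGate g x + acc) 0# C

  data AllL {A : Set c} (P : A → Set ℓ) : List A → Set (c ⊔ ℓ) where
    []  : AllL P []
    _∷_ : ∀ {a as} → P a → AllL P as → AllL P (a ∷ as)

  HomogeneousCircuit : ∀ {n r} → Circuit n r → Set (c ⊔ ℓ)
  HomogeneousCircuit {r = r} C = ∀ (i : Fin r) → AllL HomogeneousLin (Vec.lookup C i)

  -- C computes S²_n (as a polynomial identity; over an infinite field, equivalently pointwise)
  ComputesS2 : ∀ {n r} → Circuit n r → Set (c ⊔ ℓ)
  ComputesS2 {n} C = ∀ (x : Fin n → Carrier) → evalCircuit C x ≈ S2 n x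

-- Let P_{a,b}(x) = a·S²(x) + b·Σ xᵢ². Split x = (x₀, x₁, y), put t = Σ y,
-- D = a + 2b, and let α, β = D − α be the roots of z² − Dz + bD. Using t² = Σ yᵢ² + 2·S²(y),
--   D · P_{a,b}(x) = (α x₀ + β x₁ + a t)(β x₀ + α x₁ + a t) + (2b − a) · P_{a,a+b}(y),
-- so one multiplication gate disposes of two variables. Starting from S² = P_{1,0}, the
-- recursion runs through P_{1,j}, where D = 1 + 2j is invertible in characteristic zero and
-- α exists by algebraic closure; ⌈n/2⌉ gates suffice.
module Submission where

open import Defs

open import Level using (Level; _⊔_)
open import Algebra.Bundles using (CommutativeRing)
open import Data.Nat as ℕ using (ℕ; zero; suc; _≥_; ⌈_/2⌉)
import Data.Nat.Properties as ℕ
open import Data.Integer as ℤ using (ℤ; +_; -[1+_]; +[1+_]; _⊖_)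
import Data.Integer.Properties as ℤ
import Data.Maybe as Maybe
open import Data.Product using (∃; _×_; _,_)
open import Data.Fin using (Fin) renaming (zero to fzero; suc to fsuc)
open import Data.Vec.Functional using (head; tail)
open import Data.List as List using ([]; _∷_)
open import Data.Vec as Vec using ([]; _∷_)
open import Data.Vec.Properties using (lookup-map)
open import Relation.Nullary using (¬_)
open import Function using (_∘_)
open import Relation.Binary.Consequences using (dec⇒weaklyDec)
import Relation.Binary.PropositionalEquality as ≡

-- With the ring itself as coefficients the solver's normal forms are not definitionally
-- equal, so the coefficients are taken in ℤ, which maps into every commutative ring.
module IntegerCoefficientRingSolver {c ℓ} (R : CommutativeRing c ℓ) where
  open CommutativeRing R
  open import Algebra.Properties.CommutativeSemigroup +-commutativeSemigroup using (interchange)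
  open import Algebra.Properties.Ring ring using (-0#≈0#; -‿involutive; -‿+-comm; -‿distribˡ-*; -‿distribʳ-*)
  open import Algebra.Properties.Semiring.Mult.TCOptimised semiring using (1+×; ×-homo-+; ×1-homo-*)
    renaming (_×_ to _·_)
  open import Algebra.Solver.Ring.AlmostCommutativeRing using (fromCommutativeRing; _-Raw-AlmostCommutative⟶_)
  open import Relation.Binary.Reasoning.Setoid setoid

  ⟦_⟧ : ℤ → Carrier
  ⟦ + n ⟧    = n · 1#
  ⟦ -[1+ n ] ⟧ = - (suc n · 1#)

  -‿homo : ∀ i → ⟦ ℤ.- i ⟧ ≈ - ⟦ i ⟧
  -‿homo (+ zero)  = sym -0#≈0#
  -‿homo +[1+ n ]  = refl
  -‿homo -[1+ n ]  = sym (-‿involutive _)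

  ⊖-homo : ∀ m n → ⟦ m ⊖ n ⟧ ≈ m · 1# - n · 1#
  ⊖-homo zero    zero    = sym (-‿inverseʳ 0#)
  ⊖-homo zero    (suc n) = sym (+-identityˡ _)
  ⊖-homo (suc m) zero    = sym (trans (+-congˡ -0#≈0#) (+-identityʳ _))
  ⊖-homo (suc m) (suc n) = begin
    ⟦ suc m ⊖ suc n ⟧            ≡⟨ ≡.cong ⟦_⟧ (ℤ.[1+m]⊖[1+n]≡m⊖n m n) ⟩
    ⟦ m ⊖ n ⟧                    ≈⟨ ⊖-homo m n ⟩
    M - N                        ≈⟨ +-identityˡ (M - N) ⟨
    0# + (M - N)                 ≈⟨ +-congʳ (-‿inverseʳ 1#) ⟨
    (1# - 1#) + (M - N)          ≈⟨ interchange 1# M (- 1#) (- N) ⟨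
    (1# + M) + (- 1# - N)        ≈⟨ +-cong (1+× m 1#) (trans (-‿cong (1+× n 1#)) (sym (-‿+-comm 1# N))) ⟨
    suc m · 1# - suc n · 1#      ∎
    where
    M = m · 1#
    N = n · 1#

  +-homo : ∀ i j → ⟦ i ℤ.+ j ⟧ ≈ ⟦ i ⟧ + ⟦ j ⟧
  +-homo -[1+ m ] -[1+ n ] = begin
    - (suc (suc (m ℕ.+ n)) · 1#)     ≡⟨ ≡.cong (λ k → - (k · 1#)) (ℕ.+-suc (suc m) n) ⟨
    - ((suc m ℕ.+ suc n) · 1#)       ≈⟨ -‿cong (×-homo-+ 1# (suc m) (suc n)) ⟩
    - (suc m · 1# + suc n · 1#)      ≈⟨ -‿+-comm _ _ ⟨
    - (suc m · 1#) + - (suc n · 1#)  ∎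
  +-homo -[1+ m ] (+ n)    = trans (⊖-homo n (suc m)) (+-comm _ _)
  +-homo (+ m)    -[1+ n ] = ⊖-homo m (suc n)
  +-homo (+ m)    (+ n)    = ×-homo-+ 1# m n

  *-homo-+ : ∀ m j → ⟦ + m ℤ.* j ⟧ ≈ ⟦ + m ⟧ * ⟦ j ⟧
  *-homo-+ m (+ n)    = trans (reflexive (≡.cong ⟦_⟧ (≡.sym (ℤ.pos-* m n)))) (×1-homo-* m n)
  *-homo-+ m -[1+ n ] = begin
    ⟦ + m ℤ.* ℤ.- +[1+ n ] ⟧      ≡⟨ ≡.cong ⟦_⟧ (ℤ.neg-distribʳ-* (+ m) +[1+ n ]) ⟨
    ⟦ ℤ.- (+ m ℤ.* +[1+ n ]) ⟧    ≈⟨ -‿homo (+ m ℤ.* +[1+ n ]) ⟩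
    - ⟦ + m ℤ.* +[1+ n ] ⟧        ≈⟨ -‿cong (*-homo-+ m +[1+ n ]) ⟩
    - (⟦ + m ⟧ * ⟦ +[1+ n ] ⟧)    ≈⟨ -‿distribʳ-* _ _ ⟩
    ⟦ + m ⟧ * ⟦ -[1+ n ] ⟧        ∎

  *-homo : ∀ i j → ⟦ i ℤ.* j ⟧ ≈ ⟦ i ⟧ * ⟦ j ⟧
  *-homo (+ m)    j = *-homo-+ m j
  *-homo -[1+ m ] j = begin
    ⟦ ℤ.- +[1+ m ] ℤ.* j ⟧        ≡⟨ ≡.cong ⟦_⟧ (ℤ.neg-distribˡ-* +[1+ m ] j) ⟨
    ⟦ ℤ.- (+[1+ m ] ℤ.* j) ⟧      ≈⟨ -‿homo (+[1+ m ] ℤ.* j) ⟩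
    - ⟦ +[1+ m ] ℤ.* j ⟧          ≈⟨ -‿cong (*-homo-+ (suc m) j) ⟩
    - (⟦ +[1+ m ] ⟧ * ⟦ j ⟧)      ≈⟨ -‿distribˡ-* _ _ ⟩
    ⟦ -[1+ m ] ⟧ * ⟦ j ⟧          ∎

  homomorphism : ℤ.+-*-rawRing -Raw-AlmostCommutative⟶ fromCommutativeRing R
  homomorphism = record
    { ⟦_⟧    = ⟦_⟧
    ; +-homo = +-homo
    ; *-homo = *-homo
    ; -‿homo = -‿homo
    ; 0-homo = refl
    ; 1-homo = refl
    }

  open import Algebra.Solver.Ring ℤ.+-*-rawRing (fromCommutativeRing R) homomorphism
    (λ i j → Maybe.map (reflexive ∘ ≡.cong ⟦_⟧) (dec⇒weaklyDec ℤ._≟_ i j))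
    public using (solve; _:=_; _:+_; _:-_; _:*_; :-_; con)


module _ {c ℓ : Level} (F : Field c ℓ) where
  open Field F
  open FieldTheory F
  open IntegerCoefficientRingSolver commRing using (solve; _:=_; _:+_; _:-_; _:*_; :-_; con)
  open import Data.Product using (proj₁; proj₂)
  open import Relation.Binary.Reasoning.Setoid setoid

  natCast-+ : ∀ m n → natCast (m ℕ.+ n) ≈ natCast m + natCast n
  natCast-+ zero    n = sym (+-identityˡ _)
  natCast-+ (suc m) n = trans (+-congˡ (natCast-+ m n)) (sym (+-assoc _ _ _))

  1+2*natCast≉0 : CharZero → ∀ j → ¬ (1# + (natCast j + natCast j) ≈ 0#)
  1+2*natCast≉0 charZero j ≈0 = charZero (j ℕ.+ j) (trans (+-congˡ (natCast-+ j j)) ≈0)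

  monicQuadratic-root : AlgClosed → ∀ p q → ∃ λ z → z * z + p * z + q ≈ 0#
  monicQuadratic-root algClosed p q with algClosed (q ∷ p ∷ []) (ℕ.s≤s ℕ.z≤n)
  ... | z , root = z , trans (horner z p q) root
    where
    horner : ∀ z p q → z * z + p * z + q ≈ q + z * (p + z * (1# + z * 0#))
    horner = solve 3 (λ z p q → z :* z :+ p :* z :+ q := q :+ z :* (p :+ z :* (con (+ 1) :+ z :* con (+ 0)))) refl

  *-distribˡ-sumFin : ∀ {n} k (f : Fin n → Carrier) → sumFin (λ i → k * f i) ≈ k * sumFin f
  *-distribˡ-sumFin {zero}  k f = sym (zeroʳ k)
  *-distribˡ-sumFin {suc n} k f = trans (+-congˡ (*-distribˡ-sumFin k (tail f))) (sym (distribˡ k _ _))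

  sumSq : ∀ {n} → (Fin n → Carrier) → Carrier
  sumSq x = sumFin (λ i → x i * x i)

  sumFin-square : ∀ {n} (x : Fin n → Carrier) → sumFin x * sumFin x ≈ sumSq x + (S2 n x + S2 n x)
  sumFin-square {zero}  x = solve 0 (con (+ 0) :* con (+ 0) := con (+ 0) :+ (con (+ 0) :+ con (+ 0))) refl
  sumFin-square {suc n} x = begin
    (x₀ + t) * (x₀ + t)                          ≈⟨ expand x₀ t ⟩
    x₀ * x₀ + (t * t + (x₀ * t + x₀ * t))        ≈⟨ +-congˡ (+-congʳ (sumFin-square (tail x))) ⟩
    x₀ * x₀ + (q + (s + s) + (x₀ * t + x₀ * t))  ≈⟨ regroup x₀ t q s ⟩
    x₀ * x₀ + q + ((x₀ * t + s) + (x₀ * t + s))  ∎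
    where
    x₀ = head x
    t = sumFin (tail x)
    q = sumSq (tail x)
    s = S2 n (tail x)
    expand : ∀ x₀ t → (x₀ + t) * (x₀ + t) ≈ x₀ * x₀ + (t * t + (x₀ * t + x₀ * t))
    expand = solve 2 (λ x₀ t → (x₀ :+ t) :* (x₀ :+ t) := x₀ :* x₀ :+ (t :* t :+ (x₀ :* t :+ x₀ :* t))) refl
    regroup : ∀ x₀ t q s →
      x₀ * x₀ + (q + (s + s) + (x₀ * t + x₀ * t)) ≈ x₀ * x₀ + q + ((x₀ * t + s) + (x₀ * t + s))
    regroup = solve 4 (λ x₀ t q s → x₀ :* x₀ :+ (q :+ (s :+ s) :+ (x₀ :* t :+ x₀ :* t))
                                   := x₀ :* x₀ :+ q :+ ((x₀ :* t :+ s) :+ (x₀ :* t :+ s))) refl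

  pencil : Carrier → Carrier → ∀ n → (Fin n → Carrier) → Carrier
  pencil a b n x = a * S2 n x + b * sumSq x

  pencil-split : ∀ a b α x₀ x₁ t s q →
    α * α + (- (a + (b + b))) * α + b * (a + (b + b)) ≈ 0# → t * t ≈ q + (s + s) →
    (a + (b + b)) * (a * (x₀ * (x₁ + t) + (x₁ * t + s)) + b * (x₀ * x₀ + (x₁ * x₁ + q)))
      ≈ (α * x₀ + ((a + (b + b) - α) * x₁ + a * t)) * ((a + (b + b) - α) * x₀ + (α * x₁ + a * t))
        + ((b + b) - a) * (a * s + (a + b) * q)
  pencil-split a b α x₀ x₁ t s q root t²≈q+2s = begin
    D * P
      ≈⟨ solve 8 (λ a b α x₀ x₁ t s q →
           (a :+ (b :+ b)) :* (a :* (x₀ :* (x₁ :+ t) :+ (x₁ :* t :+ s)) :+ b :* (x₀ :* x₀ :+ (x₁ :* x₁ :+ q)))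
           := (α :* x₀ :+ ((a :+ (b :+ b) :- α) :* x₁ :+ a :* t)) :* ((a :+ (b :+ b) :- α) :* x₀ :+ (α :* x₁ :+ a :* t))
              :+ ((b :+ b) :- a) :* (a :* s :+ (a :+ b) :* q)
              :+ ((α :* α :+ (:- (a :+ (b :+ b))) :* α :+ b :* (a :+ (b :+ b))) :* ((x₀ :- x₁) :* (x₀ :- x₁))
                  :+ a :* a :* ((q :+ (s :+ s)) :- t :* t)))
           refl a b α x₀ x₁ t s q ⟩
    L₁L₂ + cP′ + (E * W + a * a * ((q + (s + s)) - t * t))
      ≈⟨ +-congˡ (trans (+-cong E*W≈0 a²[…]≈0) (+-identityʳ 0#)) ⟩
    L₁L₂ + cP′ + 0#
      ≈⟨ +-identityʳ _ ⟩
    L₁L₂ + cP′ ∎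
    where
    D = a + (b + b)
    β = D - α
    P = a * (x₀ * (x₁ + t) + (x₁ * t + s)) + b * (x₀ * x₀ + (x₁ * x₁ + q))
    L₁L₂ = (α * x₀ + (β * x₁ + a * t)) * (β * x₀ + (α * x₁ + a * t))
    cP′ = ((b + b) - a) * (a * s + (a + b) * q)
    E = α * α + (- D) * α + b * D
    W = (x₀ - x₁) * (x₀ - x₁)
    E*W≈0 : E * W ≈ 0#
    E*W≈0 = trans (*-congʳ root) (zeroˡ W)
    a²[…]≈0 : a * a * ((q + (s + s)) - t * t) ≈ 0#
    a²[…]≈0 = trans (*-congˡ (trans (+-congʳ (sym t²≈q+2s)) (-‿inverseʳ (t * t)))) (zeroʳ (a * a))

  weakenLin : ∀ {n} → LinForm n → LinForm (suc n)
  weakenLin (linForm a₀ a) = linForm a₀ (λ { fzero → 0# ; (fsuc i) → a i })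

  weakenGate : ∀ {n} → Gate n → Gate (suc n)
  weakenGate = List.map weakenLin

  weakenCircuit : ∀ {n r} → Circuit n r → Circuit (suc n) r
  weakenCircuit = Vec.map weakenGate

  evalLin-weaken : ∀ {n} (L : LinForm n) x → evalLin (weakenLin L) x ≈ evalLin L (tail x)
  evalLin-weaken L x = +-congˡ (trans (+-congʳ (zeroˡ (head x))) (+-identityˡ _))

  evalGate-weaken : ∀ {n} (g : Gate n) x → evalGate (weakenGate g) x ≈ evalGate g (tail x)
  evalGate-weaken []      x = refl
  evalGate-weaken (L ∷ g) x = *-cong (evalLin-weaken L x) (evalGate-weaken g x)

  evalCircuit-weaken : ∀ {n r} (C : Circuit n r) x → evalCircuit (weakenCircuit C) x ≈ evalCircuit C (tail x)
  evalCircuit-weaken []      x = refl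
  evalCircuit-weaken (g ∷ C) x = +-cong (evalGate-weaken g x) (evalCircuit-weaken C x)

  homogeneousGate-weaken : ∀ {n} {g : Gate n} → AllL HomogeneousLin g → AllL HomogeneousLin (weakenGate g)
  homogeneousGate-weaken []       = []
  homogeneousGate-weaken (h ∷ hs) = h ∷ homogeneousGate-weaken hs

  homogeneousCircuit-weaken : ∀ {n r} (C : Circuit n r) → HomogeneousCircuit C → HomogeneousCircuit (weakenCircuit C)
  homogeneousCircuit-weaken C h i =
    ≡.subst (AllL HomogeneousLin) (≡.sym (lookup-map i weakenGate C)) (homogeneousGate-weaken (h i))

  homogeneousCircuit-∷ : ∀ {n r} {g : Gate n} {C : Circuit n r} →
    AllL HomogeneousLin g → HomogeneousCircuit C → HomogeneousCircuit (g ∷ C)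
  homogeneousCircuit-∷ hg hC fzero    = hg
  homogeneousCircuit-∷ hg hC (fsuc i) = hC i

  evalGate-pair : ∀ {n} (L₁ L₂ : LinForm n) x → evalGate (L₁ ∷ L₂ ∷ []) x ≈ evalLin L₁ x * evalLin L₂ x
  evalGate-pair L₁ L₂ x = *-congˡ (*-identityʳ _)

  twoHeadForm : ∀ {n} → Carrier → Carrier → Carrier → LinForm (suc (suc n))
  twoHeadForm p q r = linForm 0# (λ { fzero → p ; (fsuc fzero) → q ; (fsuc (fsuc _)) → r })

  evalLin-twoHeadForm : ∀ {n} p q r (x : Fin (suc (suc n)) → Carrier) →
    evalLin (twoHeadForm p q r) x ≈ p * head x + (q * head (tail x) + r * sumFin (tail (tail x)))
  evalLin-twoHeadForm p q r x =
    trans (+-identityˡ _) (+-congˡ (+-congˡ (*-distribˡ-sumFin r (tail (tail x)))))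

  HasHomogeneousCircuit : ∀ n r → ((Fin n → Carrier) → Carrier) → Set (c ⊔ ℓ)
  HasHomogeneousCircuit n r f = ∃ λ (C : Circuit n r) → HomogeneousCircuit C × (∀ x → evalCircuit C x ≈ f x)

  pencil-circuit-step : AlgClosed → ∀ {m r} a b D⁻¹ → (a + (b + b)) * D⁻¹ ≈ 1# → ∀ μ →
    HasHomogeneousCircuit m r (λ y → μ * D⁻¹ * ((b + b) - a) * pencil a (a + b) m y) →
    HasHomogeneousCircuit (suc (suc m)) (suc r) (λ x → μ * pencil a b (suc (suc m)) x)
  pencil-circuit-step algClosed {m} a b D⁻¹ DD⁻¹≈1 μ (C , homC , evalC) =
    gate ∷ weakenCircuit (weakenCircuit C) ,
    homogeneousCircuit-∷ (refl ∷ refl ∷ [])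
      (homogeneousCircuit-weaken (weakenCircuit C) (homogeneousCircuit-weaken C homC)) ,
    evalCircuit-gate∷C
    where
    D = a + (b + b)
    root = monicQuadratic-root algClosed (- D) (b * D)
    α = proj₁ root
    β = D - α
    k = μ * D⁻¹
    γ = (b + b) - a
    L₁ L₂ : LinForm (suc (suc m))
    L₁ = twoHeadForm (k * α) (k * β) (k * a)
    L₂ = twoHeadForm β α a
    gate : Gate (suc (suc m))
    gate = L₁ ∷ L₂ ∷ []
    evalCircuit-gate∷C : ∀ x →
      evalCircuit (gate ∷ weakenCircuit (weakenCircuit C)) x ≈ μ * pencil a b (suc (suc m)) x
    evalCircuit-gate∷C x = begin
      evalGate gate x + evalCircuit (weakenCircuit (weakenCircuit C)) x
        ≈⟨ +-cong (trans (evalGate-pair L₁ L₂ x)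
                         (*-cong (evalLin-twoHeadForm (k * α) (k * β) (k * a) x) (evalLin-twoHeadForm β α a x)))
                  (trans (evalCircuit-weaken (weakenCircuit C) x)
                         (trans (evalCircuit-weaken C (tail x)) (evalC y))) ⟩
      (k * α * x₀ + (k * β * x₁ + k * a * t)) * (β * x₀ + (α * x₁ + a * t)) + k * γ * P′
        ≈⟨ factor k α β a x₀ x₁ t γ P′ ⟩
      k * ((α * x₀ + (β * x₁ + a * t)) * (β * x₀ + (α * x₁ + a * t)) + γ * P′)
        ≈⟨ *-congˡ (pencil-split a b α x₀ x₁ t (S2 m y) (sumSq y) (proj₂ root) (sumFin-square y)) ⟨
      μ * D⁻¹ * (D * pencil a b (suc (suc m)) x)
        ≈⟨ cancel μ D⁻¹ D _ ⟩
      μ * ((D * D⁻¹) * pencil a b (suc (suc m)) x)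
        ≈⟨ *-congˡ (trans (*-congʳ DD⁻¹≈1) (*-identityˡ _)) ⟩
      μ * pencil a b (suc (suc m)) x ∎
      where
      y = tail (tail x)
      x₀ = head x
      x₁ = head (tail x)
      t = sumFin y
      P′ = pencil a (a + b) m y
      factor : ∀ k α β a x₀ x₁ t γ P′ →
        (k * α * x₀ + (k * β * x₁ + k * a * t)) * (β * x₀ + (α * x₁ + a * t)) + k * γ * P′
          ≈ k * ((α * x₀ + (β * x₁ + a * t)) * (β * x₀ + (α * x₁ + a * t)) + γ * P′)
      factor = solve 9 (λ k α β a x₀ x₁ t γ P′ →
        (k :* α :* x₀ :+ (k :* β :* x₁ :+ k :* a :* t)) :* (β :* x₀ :+ (α :* x₁ :+ a :* t)) :+ k :* γ :* P′
        := k :* ((α :* x₀ :+ (β :* x₁ :+ a :* t)) :* (β :* x₀ :+ (α :* x₁ :+ a :* t)) :+ γ :* P′)) refl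
      cancel : ∀ μ D⁻¹ D P → μ * D⁻¹ * (D * P) ≈ μ * ((D * D⁻¹) * P)
      cancel = solve 4 (λ μ D⁻¹ D P → μ :* D⁻¹ :* (D :* P) := μ :* ((D :* D⁻¹) :* P)) refl

  pencil-circuit : CharZero → AlgClosed → ∀ m j μ →
    HasHomogeneousCircuit m ⌈ m /2⌉ (λ x → μ * pencil 1# (natCast j) m x)
  pencil-circuit charZero algClosed zero j μ =
    [] , (λ ()) , λ _ → empty μ (natCast j)
    where
    empty : ∀ μ b → 0# ≈ μ * (1# * 0# + b * 0#)
    empty = solve 2 (λ μ b → con (+ 0) := μ :* (con (+ 1) :* con (+ 0) :+ b :* con (+ 0))) refl
  pencil-circuit charZero algClosed (suc zero) j μ =
    (linForm 0# (λ _ → μ * natCast j) ∷ linForm 0# (λ _ → 1#) ∷ []) ∷ [] ,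
    (λ { fzero → refl ∷ refl ∷ [] }) ,
    λ x → square μ (natCast j) (head x)
    where
    square : ∀ μ b x₀ → (0# + (μ * b * x₀ + 0#)) * ((0# + (1# * x₀ + 0#)) * 1#) + 0#
                       ≈ μ * (1# * (x₀ * 0# + 0#) + b * (x₀ * x₀ + 0#))
    square = solve 3 (λ μ b x₀ →
      (con (+ 0) :+ (μ :* b :* x₀ :+ con (+ 0)))
        :* ((con (+ 0) :+ (con (+ 1) :* x₀ :+ con (+ 0))) :* con (+ 1)) :+ con (+ 0)
      := μ :* (con (+ 1) :* (x₀ :* con (+ 0) :+ con (+ 0)) :+ b :* (x₀ :* x₀ :+ con (+ 0)))) refl
  pencil-circuit charZero algClosed (suc (suc m)) j μ
    with inverse (1# + (natCast j + natCast j)) (1+2*natCast≉0 charZero j)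
  ... | D⁻¹ , DD⁻¹≈1 =
    pencil-circuit-step algClosed 1# (natCast j) D⁻¹ DD⁻¹≈1 μ (pencil-circuit charZero algClosed m (suc j) _)

  S2-circuit : CharZero → AlgClosed → ∀ n → HasHomogeneousCircuit n ⌈ n /2⌉ (S2 n)
  S2-circuit charZero algClosed n with pencil-circuit charZero algClosed n 0 1#
  ... | C , homC , evalC = C , homC , λ x → trans (evalC x) (pencil-1-0 (S2 n x) (sumSq x))
    where
    pencil-1-0 : ∀ s q → 1# * (1# * s + 0# * q) ≈ s
    pencil-1-0 = solve 2 (λ s q → con (+ 1) :* (con (+ 1) :* s :+ con (+ 0) :* q) := s) refl

-- The construction covers n = 0 as well.
mainTheorem5 : ∀ {c ℓ : Level} (F : Field c ℓ) → FieldTheory.CharZero F → FieldTheory.AlgClosed F →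
                 ∀ (n : ℕ) → n ≥ 1 →
                 ∃ λ (C : FieldTheory.Circuit F n ⌈ n /2⌉) →
                   FieldTheory.HomogeneousCircuit F C × FieldTheory.ComputesS2 F C
mainTheorem5 F charZero algClosed n _ = S2-circuit F charZero algClosed n
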